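{- Let $n_1\ge n_2\ge 2$ and $n_3\ge 1$ be integers. Then $H(G_{n_1,n_2,n_3})<H(G_{n_1+1,n_2-1,n_3})$, where $G_{a,b,c}=(K_a\cup K_b)\vee K_c$.
   Context: All graphs are finite and simple. For a graph $G$, $d_G(u,v)$ is the length of a shortest $u$–$v$ path, and the Harary index is $H(G)=\sum_{\{u,v\}\subseteq V(G),\,u\neq v} \frac{1}{d_G(u,v)}$ (sum over unordered pairs of distinct vertices). $K_m$ is the complete graph on $m$ vertices. For vertex-disjoint graphs $G,H$, $G\cup H$ is their disjoint union and $G\vee H$ is obtained from $G\cup H$ by adding all edges between $V(G)$ and $V(H)$. -}

module Defs where

open import Data.Nat as ℕ using (ℕ; zero; suc; _+_)
open import Data.Fin as Fin using (Fin; toℕ; splitAt)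
open import Data.Bool using (Bool; true; false; not; _∧_; _∨_; if_then_else_)
open import Data.Sum using (_⊎_; inj₁; inj₂)
open import Data.List using (List; map; foldr; allFin)
open import Data.Bool.ListAction using (any)
open import Data.Maybe using (Maybe; just; nothing)
open import Data.Integer using (+_)
open import Data.Rational as ℚ using (ℚ; 0ℚ; _/_)
open import Relation.Nullary.Decidable using (⌊_⌋)

record Graph : Set where
  field
    order : ℕ
    adj   : Fin order → Fin order → Bool
open Graph public

K : ℕ → Graph
K m = record { order = m ; adj = λ u v → not ⌊ u Fin.≟ v ⌋ }

_∪ᴳ_ : Graph → Graph → Graph
G ∪ᴳ H = record { order = order G + order H ; adj = a }
  where
  a : Fin (order G + order H) → Fin (order G + order H) → Bool
  a u v with splitAt (order G) u | splitAt (order G) v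
  ... | inj₁ x | inj₁ y = adj G x y
  ... | inj₂ x | inj₂ y = adj H x y
  ... | _      | _      = false

_∨ᴳ_ : Graph → Graph → Graph
G ∨ᴳ H = record { order = order G + order H ; adj = a }
  where
  a : Fin (order G + order H) → Fin (order G + order H) → Bool
  a u v with splitAt (order G) u | splitAt (order G) v
  ... | inj₁ x | inj₁ y = adj G x y
  ... | inj₂ x | inj₂ y = adj H x y
  ... | _      | _      = true

reach : (G : Graph) → ℕ → Fin (order G) → Fin (order G) → Bool
reach G zero    u v = ⌊ u Fin.≟ v ⌋
reach G (suc k) u v =
  reach G k u v ∨ any (λ w → reach G k u w ∧ adj G w v) (allFin (order G))

search : (ℕ → Bool) → ℕ → ℕ → Maybe ℕ
search p i zero = if p i then just i else nothing
search p i (suc fuel) = if p i then just i else search p (suc i) fuel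

-- d_G(u,v): length of a shortest u–v path (nothing if u, v are in different
-- components).  Shortest paths have length < order G, so searching
-- k = 0, …, order G suffices.
dist : (G : Graph) → Fin (order G) → Fin (order G) → Maybe ℕ
dist G u v = search (λ k → reach G k u v) 0 (order G)

-- 1/d, with 0 for unreachable pairs (never used in the theorem: graphs are connected)
recip : Maybe ℕ → ℚ
recip (just (suc k)) = + 1 / suc k
recip _              = 0ℚ

sumℚ : List ℚ → ℚ
sumℚ = foldr ℚ._+_ 0ℚ

harary : Graph → ℚ
harary G = sumℚ (map (λ u → sumℚ (map (λ v →
             if toℕ u ℕ.<ᵇ toℕ v then recip (dist G u v) else 0ℚ)
             (allFin (order G)))) (allFin (order G)))

Gabc : ℕ → ℕ → ℕ → Graph
Gabc a b c = (K a ∪ᴳ K b) ∨ᴳ K c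

-- If c ≥ 1, two distinct vertices of G_{a,b,c} = (K_a ∪ K_b) ∨ K_c are adjacent unless one
-- lies in K_a and the other in K_b, and such a pair is at distance 2 through any vertex of
-- K_c.  Summing 1/d over all pairs gives 2·H(G_{a,b,c}) + ab = n(n−1) with n = a + b + c,
-- so for fixed n the index strictly decreases in ab.  Moving a vertex from K_b to K_a when
-- b ≤ a replaces ab by (a + 1)(b − 1) = ab − (a − b + 1) < ab.

module Submission where

open import Defs
open import Data.Nat using (ℕ; suc; _≤_; _∸_)
open import Data.Rational using (_<_)

open import Data.Bool using (Bool; true; false; not; T; if_then_else_; _∧_)
open import Data.Bool.Properties using (T-≡; T-∨; T-∧)
open import Data.Empty using (⊥-elim)
open import Data.Fin as Fin using (Fin; toℕ; _↑ˡ_; _↑ʳ_; splitAt)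
open import Data.Fin.Properties using (toℕ<n; toℕ-↑ˡ; toℕ-↑ʳ; splitAt-↑ˡ; splitAt-↑ʳ; splitAt⁻¹-↑ˡ; splitAt⁻¹-↑ʳ)
open import Data.List using (allFin; map; tabulate)
open import Data.List.Properties using (map-cong; map-tabulate)
open import Data.List.Membership.Propositional using (lose; find)
open import Data.List.Membership.Propositional.Properties using (∈-allFin)
open import Data.List.Relation.Unary.Any.Properties using (any⁺; any⁻)
open import Data.Maybe as Maybe using (just)
import Data.Nat.Properties as ℕP
open import Data.Nat as ℕ using (zero; _+_; _*_; z≤n; s≤s; _<ᵇ_)
open import Algebra.Properties.Semiring.Sum ℕP.+-*-semiring
  using (sum-syntax; sum-cong-≗; sum-replicate-zero; ∑-distrib-+; *-distribˡ-sum; *-distribʳ-sum)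
open import Data.Product using (_,_; _×_)
open import Data.Rational as ℚ using (ℚ; 0ℚ; ½)
import Data.Rational.Properties as ℚP
open import Algebra.Properties.Monoid.Mult ℚP.+-0-monoid using (×-homo-+) renaming (_×_ to _×ℚ_)
open import Data.Sum using (inj₁; inj₂)
open import Function using (_∘_; id; Equivalence)
open import Relation.Binary.PropositionalEquality
open import Relation.Nullary using (¬_; contradiction)
open import Relation.Nullary.Decidable using (dec-true; dec-false; isYes≗does; T?; fromWitness; toWitness)

search-hit : ∀ {p i} f → p i ≡ true → search p i f ≡ just i
search-hit zero    e rewrite e = refl
search-hit (suc f) e rewrite e = refl

search-miss : ∀ {p i} f → p i ≡ false → search p i (suc f) ≡ search p (suc i) f
search-miss f e rewrite e = refl

search-shift : ∀ (p : ℕ → Bool) i f → search p (suc i) f ≡ Maybe.map suc (search (p ∘ suc) i f)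
search-shift p i zero    with p (suc i)
... | true  = refl
... | false = refl
search-shift p i (suc f) with p (suc i)
... | true  = refl
... | false = search-shift p (suc i) f

search-least : ∀ {p} k f → k ≤ f → (∀ j → j ℕ.< k → p j ≡ false) → p k ≡ true → search p 0 f ≡ just k
search-least zero    f       _         _    hit = search-hit f hit
search-least {p} (suc k) (suc f) (s≤s k≤f) miss hit = begin
  search p 0 (suc f)                    ≡⟨ search-miss f (miss 0 (s≤s z≤n)) ⟩
  search p 1 f                          ≡⟨ search-shift p 0 f ⟩
  Maybe.map suc (search (p ∘ suc) 0 f)  ≡⟨ cong (Maybe.map suc) shifted ⟩
  just (suc k)                          ∎
  where
  shifted : search (p ∘ suc) 0 f ≡ just k
  shifted = search-least k f k≤f (λ j → miss (suc j) ∘ s≤s) hit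
  open ≡-Reasoning

distinct⇒2≤ : ∀ {n} {u v : Fin n} → u ≢ v → 2 ≤ n
distinct⇒2≤ {suc zero}    {Fin.zero} {Fin.zero} u≢v = contradiction refl u≢v
distinct⇒2≤ {suc (suc n)} _ = s≤s (s≤s z≤n)

module _ (G : Graph) where

  reach-refl : ∀ {u} → T (reach G 0 u u)
  reach-refl = fromWitness refl

  reach-suc : ∀ {k u w v} → T (reach G k u w) → T (adj G w v) → T (reach G (suc k) u v)
  reach-suc {w = w} r e =
    Equivalence.from T-∨ (inj₂ (any⁺ _ (lose (∈-allFin w) (Equivalence.from T-∧ (r , e)))))

  reach-0⇒≡ : ∀ {u v} → T (reach G 0 u v) → u ≡ v
  reach-0⇒≡ = toWitness

  reach-1⇒adj : ∀ {u v} → u ≢ v → T (reach G 1 u v) → T (adj G u v)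
  reach-1⇒adj {u} {v} u≢v r with Equivalence.to T-∨ r
  ... | inj₁ r₀ = contradiction (reach-0⇒≡ r₀) u≢v
  ... | inj₂ r₁ with find (any⁻ (λ w → reach G 0 u w ∧ adj G w v) (allFin (order G)) r₁)
  ...   | w , _ , r₀∧e with Equivalence.to T-∧ r₀∧e
  ...     | r₀ , e = subst (λ x → T (adj G x v)) (sym (reach-0⇒≡ r₀)) e

  dist-least : ∀ {u v} k → k ≤ order G → (∀ j → j ℕ.< k → ¬ T (reach G j u v)) → T (reach G k u v) →
               dist G u v ≡ just k
  dist-least k k≤n unreached reached =
    search-least k (order G) k≤n (λ j j<k → dec-false (T? _) (unreached j j<k)) (dec-true (T? _) reached)

  dist-adjacent : ∀ {u v} → u ≢ v → adj G u v ≡ true → dist G u v ≡ just 1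
  dist-adjacent {u} u≢v e = dist-least 1 (ℕP.≤-trans (s≤s z≤n) (toℕ<n u)) unreached
    (reach-suc {k = 0} {u = u} reach-refl (Equivalence.from T-≡ e))
    where
    unreached : ∀ j → j ℕ.< 1 → ¬ T (reach G j _ _)
    unreached zero    _         = u≢v ∘ reach-0⇒≡
    unreached (suc _) (s≤s ())

  dist-common-neighbour : ∀ {u w v} → u ≢ v → adj G u v ≡ false → adj G u w ≡ true → adj G w v ≡ true →
                          dist G u v ≡ just 2
  dist-common-neighbour {u} u≢v ¬uv uw wv = dist-least 2 (distinct⇒2≤ u≢v) unreached
    (reach-suc {k = 1} {u = u} (reach-suc {k = 0} {u = u} reach-refl (Equivalence.from T-≡ uw))
                               (Equivalence.from T-≡ wv))
    where
    unreached : ∀ j → j ℕ.< 2 → ¬ T (reach G j _ _)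
    unreached zero          _               = u≢v ∘ reach-0⇒≡
    unreached (suc zero)    _               = subst T ¬uv ∘ reach-1⇒adj u≢v
    unreached (suc (suc _)) (s≤s (s≤s ()))

halves : ℕ → ℚ
halves n = n ×ℚ ½

sumℚ-tabulate-halves : ∀ {n} (h : Fin n → ℕ) → sumℚ (tabulate (halves ∘ h)) ≡ halves (∑[ i < n ] h i)
sumℚ-tabulate-halves {zero}  h = refl
sumℚ-tabulate-halves {suc n} h =
  trans (cong (halves (h Fin.zero) ℚ.+_) (sumℚ-tabulate-halves (h ∘ Fin.suc)))
        (sym (×-homo-+ ½ (h Fin.zero) (∑[ i < n ] h (Fin.suc i))))

sumℚ-halves : ∀ {n} (h : Fin n → ℕ) → sumℚ (map (halves ∘ h) (allFin n)) ≡ halves (∑[ i < n ] h i)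
sumℚ-halves h = trans (cong sumℚ (map-tabulate id (halves ∘ h))) (sumℚ-tabulate-halves h)

harary-halves : ∀ G (h : Fin (order G) → Fin (order G) → ℕ) →
  (∀ u v → (if toℕ u <ᵇ toℕ v then recip (dist G u v) else 0ℚ) ≡ halves (h u v)) →
  harary G ≡ halves (∑[ u < order G ] ∑[ v < order G ] h u v)
harary-halves G h term≡ =
  trans (cong sumℚ (map-cong (λ u → trans (cong sumℚ (map-cong (term≡ u) (allFin _))) (sumℚ-halves (h u)))
                             (allFin _)))
        (sumℚ-halves (λ u → ∑[ v < order G ] h u v))

halves-<-suc : ∀ n → halves n < halves (suc n)
halves-<-suc n = subst (_< halves (suc n)) (ℚP.+-identityˡ (halves n)) (ℚP.+-monoˡ-< (halves n) (ℚP.positive⁻¹ ½))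

halves-< : ∀ {m n} → m ℕ.< n → halves m < halves n
halves-< {n = suc n} m<1+n with ℕP.m<1+n⇒m<n∨m≡n m<1+n
... | inj₁ m<n  = ℚP.<-trans (halves-< m<n) (halves-<-suc n)
... | inj₂ refl = halves-<-suc n

module _ (G H : Graph) where
  private
    m n : ℕ
    m = order G
    n = order H

  ∪-adj-ˡˡ : ∀ x y → adj (G ∪ᴳ H) (x ↑ˡ n) (y ↑ˡ n) ≡ adj G x y
  ∪-adj-ˡˡ x y rewrite splitAt-↑ˡ m x n | splitAt-↑ˡ m y n = refl

  ∪-adj-ʳʳ : ∀ x y → adj (G ∪ᴳ H) (m ↑ʳ x) (m ↑ʳ y) ≡ adj H x y
  ∪-adj-ʳʳ x y rewrite splitAt-↑ʳ m n x | splitAt-↑ʳ m n y = refl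

  ∪-adj-ˡʳ : ∀ x y → adj (G ∪ᴳ H) (x ↑ˡ n) (m ↑ʳ y) ≡ false
  ∪-adj-ˡʳ x y rewrite splitAt-↑ˡ m x n | splitAt-↑ʳ m n y = refl

  ∨-adj-ˡˡ : ∀ x y → adj (G ∨ᴳ H) (x ↑ˡ n) (y ↑ˡ n) ≡ adj G x y
  ∨-adj-ˡˡ x y rewrite splitAt-↑ˡ m x n | splitAt-↑ˡ m y n = refl

  ∨-adj-ʳʳ : ∀ x y → adj (G ∨ᴳ H) (m ↑ʳ x) (m ↑ʳ y) ≡ adj H x y
  ∨-adj-ʳʳ x y rewrite splitAt-↑ʳ m n x | splitAt-↑ʳ m n y = refl

  ∨-adj-ˡʳ : ∀ x y → adj (G ∨ᴳ H) (x ↑ˡ n) (m ↑ʳ y) ≡ true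
  ∨-adj-ˡʳ x y rewrite splitAt-↑ˡ m x n | splitAt-↑ʳ m n y = refl

  ∨-adj-ʳˡ : ∀ x y → adj (G ∨ᴳ H) (m ↑ʳ x) (y ↑ˡ n) ≡ true
  ∨-adj-ʳˡ x y rewrite splitAt-↑ʳ m n x | splitAt-↑ˡ m y n = refl

K-adj : ∀ {m} {x y : Fin m} → x ≢ y → adj (K m) x y ≡ true
K-adj {x = x} {y} x≢y = cong not (trans (isYes≗does (x Fin.≟ y)) (dec-false (x Fin.≟ y) x≢y))

data Part : Set where
  A B C : Part

rank : Part → ℕ
rank A = 0
rank B = 1
rank C = 2

isA isB : Part → Bool
isA A = true
isA _ = false
isB B = true
isB _ = false

crossing : Part → Part → Bool
crossing p q = isA p ∧ isB q

crossing-ends : ∀ {p q} → crossing p q ≡ true → p ≡ A × q ≡ B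
crossing-ends {A} {B} refl = refl , refl

-- The clique containing the vertex of index i in Gabc a b c, whose vertices are numbered
-- K_a first, then K_b, then K_c.
part : ℕ → ℕ → ℕ → Part
part zero    zero    _       = C
part zero    (suc b) zero    = B
part zero    (suc b) (suc i) = part zero b i
part (suc a) b       zero    = A
part (suc a) b       (suc i) = part a b i

part-A : ∀ {a} b (x : Fin a) → part a b (toℕ x) ≡ A
part-A b Fin.zero    = refl
part-A b (Fin.suc x) = part-A b x

part-B : ∀ a {b} (y : Fin b) → part a b (a + toℕ y) ≡ B
part-B (suc a) y           = part-B a y
part-B zero    Fin.zero    = refl
part-B zero    (Fin.suc y) = part-B zero y

part-C : ∀ a b k → part a b (a + b + k) ≡ C
part-C (suc a) b       k = part-C a b k
part-C zero    (suc b) k = part-C zero b k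
part-C zero    zero    k = refl

1≤rank-part-zero : ∀ b i → 1 ≤ rank (part zero b i)
1≤rank-part-zero zero    i       = s≤s z≤n
1≤rank-part-zero (suc b) zero    = s≤s z≤n
1≤rank-part-zero (suc b) (suc i) = 1≤rank-part-zero b i

part-mono : ∀ a b {i j} → i ≤ j → rank (part a b i) ≤ rank (part a b j)
part-mono (suc a) b       {zero}          _         = z≤n
part-mono (suc a) b       {suc i} {suc j} (s≤s i≤j) = part-mono a b i≤j
part-mono zero    zero    _                         = ℕP.≤-refl
part-mono zero    (suc b) {zero}  {zero}  _         = ℕP.≤-refl
part-mono zero    (suc b) {zero}  {suc j} _         = 1≤rank-part-zero b j
part-mono zero    (suc b) {suc i} {suc j} (s≤s i≤j) = part-mono zero b i≤j

crossing⇒< : ∀ a b {i j} → crossing (part a b i) (part a b j) ≡ true → i ℕ.< j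
crossing⇒< a b cr with crossing-ends cr
... | i∈A , j∈B = ℕP.≰⇒> λ j≤i →
  contradiction (subst₂ (λ p q → rank p ≤ rank q) j∈B i∈A (part-mono a b j≤i)) λ ()

data Vertex (a b c : ℕ) : Fin (a + b + c) → Set where
  inA : (x : Fin a) → Vertex a b c ((x ↑ˡ b) ↑ˡ c)
  inB : (y : Fin b) → Vertex a b c ((a ↑ʳ y) ↑ˡ c)
  inC : (z : Fin c) → Vertex a b c ((a + b) ↑ʳ z)

vertex : ∀ a b c (u : Fin (a + b + c)) → Vertex a b c u
vertex a b c u with splitAt (a + b) u in u≡
... | inj₂ z = subst (Vertex a b c) (splitAt⁻¹-↑ʳ u≡) (inC z)
... | inj₁ x with splitAt a x in x≡
...   | inj₁ x′ = subst (Vertex a b c) (trans (cong (_↑ˡ c) (splitAt⁻¹-↑ˡ x≡)) (splitAt⁻¹-↑ˡ u≡)) (inA x′)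
...   | inj₂ y  = subst (Vertex a b c) (trans (cong (_↑ˡ c) (splitAt⁻¹-↑ʳ x≡)) (splitAt⁻¹-↑ˡ u≡)) (inB y)

module _ (a b c : ℕ) where

  part-inA : (x : Fin a) → part a b (toℕ ((x ↑ˡ b) ↑ˡ c)) ≡ A
  part-inA x rewrite toℕ-↑ˡ (x ↑ˡ b) c | toℕ-↑ˡ x b = part-A b x

  part-inB : (y : Fin b) → part a b (toℕ ((a ↑ʳ y) ↑ˡ c)) ≡ B
  part-inB y rewrite toℕ-↑ˡ (a ↑ʳ y) c | toℕ-↑ʳ a y = part-B a y

  part-inC : (z : Fin c) → part a b (toℕ ((a + b) ↑ʳ z)) ≡ C
  part-inC z rewrite toℕ-↑ʳ (a + b) z = part-C a b (toℕ z)

  private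
    rank-ordered : ∀ {u v : Fin (a + b + c)} {p q} → toℕ u ℕ.< toℕ v →
                   part a b (toℕ u) ≡ p → part a b (toℕ v) ≡ q → rank p ≤ rank q
    rank-ordered u<v refl refl = part-mono a b (ℕP.<⇒≤ u<v)

  adj-Gabc : ∀ {u v : Fin (a + b + c)} → toℕ u ℕ.< toℕ v →
             adj (Gabc a b c) u v ≡ not (crossing (part a b (toℕ u)) (part a b (toℕ v)))
  adj-Gabc {u} {v} u<v with vertex a b c u | vertex a b c v
  ... | inA x | inA y rewrite part-inA x | part-inA y =
    trans (∨-adj-ˡˡ (K a ∪ᴳ K b) (K c) _ _)
          (trans (∪-adj-ˡˡ (K a) (K b) x y) (K-adj λ { refl → ℕP.<-irrefl refl u<v }))
  ... | inA x | inB y rewrite part-inA x | part-inB y =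
    trans (∨-adj-ˡˡ (K a ∪ᴳ K b) (K c) _ _) (∪-adj-ˡʳ (K a) (K b) x y)
  ... | inA x | inC z rewrite part-inA x | part-inC z = ∨-adj-ˡʳ (K a ∪ᴳ K b) (K c) _ z
  ... | inB x | inA y = contradiction (rank-ordered u<v (part-inB x) (part-inA y)) λ ()
  ... | inB x | inB y rewrite part-inB x =
    trans (∨-adj-ˡˡ (K a ∪ᴳ K b) (K c) _ _)
          (trans (∪-adj-ʳʳ (K a) (K b) x y) (K-adj λ { refl → ℕP.<-irrefl refl u<v }))
  ... | inB x | inC z rewrite part-inB x = ∨-adj-ˡʳ (K a ∪ᴳ K b) (K c) _ z
  ... | inC z | inA y = contradiction (rank-ordered u<v (part-inC z) (part-inA y)) λ ()
  ... | inC z | inB y = contradiction (rank-ordered u<v (part-inC z) (part-inB y)) λ { (s≤s ()) }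
  ... | inC z | inC w rewrite part-inC z =
    trans (∨-adj-ʳʳ (K a ∪ᴳ K b) (K c) z w) (K-adj λ { refl → ℕP.<-irrefl refl u<v })

module _ (a b c : ℕ) where

  hub : Fin (a + b + suc c)
  hub = (a + b) ↑ʳ Fin.zero

  hub-adjʳ : ∀ {u} → part a b (toℕ u) ≢ C → adj (Gabc a b (suc c)) u hub ≡ true
  hub-adjʳ {u} ≢C with vertex a b (suc c) u
  ... | inA x = ∨-adj-ˡʳ (K a ∪ᴳ K b) (K (suc c)) _ _
  ... | inB y = ∨-adj-ˡʳ (K a ∪ᴳ K b) (K (suc c)) _ _
  ... | inC z = contradiction (part-inC a b (suc c) z) ≢C

  hub-adjˡ : ∀ {v} → part a b (toℕ v) ≢ C → adj (Gabc a b (suc c)) hub v ≡ true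
  hub-adjˡ {v} ≢C with vertex a b (suc c) v
  ... | inA x = ∨-adj-ʳˡ (K a ∪ᴳ K b) (K (suc c)) _ _
  ... | inB y = ∨-adj-ʳˡ (K a ∪ᴳ K b) (K (suc c)) _ _
  ... | inC z = contradiction (part-inC a b (suc c) z) ≢C

inverse-distance-Gabc : ∀ a b c {u v : Fin (a + b + suc c)} → toℕ u ℕ.< toℕ v →
  recip (dist (Gabc a b (suc c)) u v)
    ≡ halves (if crossing (part a b (toℕ u)) (part a b (toℕ v)) then 1 else 2)
inverse-distance-Gabc a b c {u} {v} u<v with crossing (part a b (toℕ u)) (part a b (toℕ v)) in cr
... | false = cong recip (dist-adjacent (Gabc a b (suc c)) (ℕP.<⇒≢ u<v ∘ cong toℕ)
                (trans (adj-Gabc a b (suc c) u<v) (cong not cr)))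
... | true with crossing-ends cr
...   | u∈A , v∈B = cong recip (dist-common-neighbour (Gabc a b (suc c)) (ℕP.<⇒≢ u<v ∘ cong toℕ)
                      (trans (adj-Gabc a b (suc c) u<v) (cong not cr))
                      (hub-adjʳ a b c (subst (_≢ C) (sym u∈A) λ ()))
                      (hub-adjˡ a b c (subst (_≢ C) (sym v∈B) λ ())))

⟦_⟧ : Bool → ℕ
⟦ true  ⟧ = 1
⟦ false ⟧ = 0

⟦∧⟧ : ∀ x y → ⟦ x ∧ y ⟧ ≡ ⟦ x ⟧ * ⟦ y ⟧
⟦∧⟧ true  y = sym (ℕP.+-identityʳ ⟦ y ⟧)
⟦∧⟧ false y = refl

∑-zero : ∀ n {f : Fin n → ℕ} → (∀ i → f i ≡ 0) → ∑[ i < n ] f i ≡ 0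
∑-zero n f≗0 = trans (sum-cong-≗ f≗0) (sum-replicate-zero n)

∑∑-cong : ∀ m n {f g : Fin m → Fin n → ℕ} → (∀ i j → f i j ≡ g i j) →
          ∑[ i < m ] ∑[ j < n ] f i j ≡ ∑[ i < m ] ∑[ j < n ] g i j
∑∑-cong m n f≗g = sum-cong-≗ (λ i → sum-cong-≗ (f≗g i))

count-A : ∀ n a b → a + b ≤ n → ∑[ i < n ] ⟦ isA (part a b (toℕ i)) ⟧ ≡ a
count-A n       zero    b _         = ∑-zero n (λ i → notA (1≤rank-part-zero b (toℕ i)))
  where
  notA : ∀ {p} → 1 ≤ rank p → ⟦ isA p ⟧ ≡ 0
  notA {B} _ = refl
  notA {C} _ = refl
count-A (suc n) (suc a) b (s≤s a+b≤n) = cong suc (count-A n a b a+b≤n)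

count-B : ∀ n a b → a + b ≤ n → ∑[ i < n ] ⟦ isB (part a b (toℕ i)) ⟧ ≡ b
count-B n       zero    zero    _         = ∑-zero n (λ _ → refl)
count-B (suc n) zero    (suc b) (s≤s b≤n) = cong suc (count-B n zero b b≤n)
count-B (suc n) (suc a) b       (s≤s a+b≤n) = count-B n a b a+b≤n

count-crossing : ∀ n a b → a + b ≤ n →
  ∑[ i < n ] ∑[ j < n ] ⟦ crossing (part a b (toℕ i)) (part a b (toℕ j)) ⟧ ≡ a * b
count-crossing n a b a+b≤n = begin
  ∑[ i < n ] ∑[ j < n ] ⟦ crossing (pt i) (pt j) ⟧
    ≡⟨ ∑∑-cong n n (λ i j → ⟦∧⟧ (isA (pt i)) (isB (pt j))) ⟩
  ∑[ i < n ] ∑[ j < n ] (⟦ isA (pt i) ⟧ * ⟦ isB (pt j) ⟧)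
    ≡⟨ sum-cong-≗ (λ i → sym (*-distribˡ-sum ⟦ isA (pt i) ⟧ (λ j → ⟦ isB (pt j) ⟧))) ⟩
  ∑[ i < n ] (⟦ isA (pt i) ⟧ * ∑[ j < n ] ⟦ isB (pt j) ⟧)
    ≡⟨ sym (*-distribʳ-sum (∑[ j < n ] ⟦ isB (pt j) ⟧) (λ i → ⟦ isA (pt i) ⟧)) ⟩
  ∑[ i < n ] ⟦ isA (pt i) ⟧ * ∑[ j < n ] ⟦ isB (pt j) ⟧
    ≡⟨ cong₂ _*_ (count-A n a b a+b≤n) (count-B n a b a+b≤n) ⟩
  a * b
    ∎
  where
  open ≡-Reasoning
  pt : Fin n → Part
  pt i = part a b (toℕ i)

-- 2 / d(u, v) for the vertices of indices i < j in G_{a,b,c}, c ≥ 1; the pairs with i ≥ j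
-- contribute 0, as in the definition of harary.
twiceInverseDistance : ℕ → ℕ → ℕ → ℕ → ℕ
twiceInverseDistance a b i j =
  if i <ᵇ j then (if crossing (part a b i) (part a b j) then 1 else 2) else 0

twiceInverseDistance-+-crossing : ∀ a b i j →
  twiceInverseDistance a b i j + ⟦ crossing (part a b i) (part a b j) ⟧ ≡ 2 * ⟦ i <ᵇ j ⟧
twiceInverseDistance-+-crossing a b i j
  with i <ᵇ j in i<ᵇj | crossing (part a b i) (part a b j) in cr
... | true  | true  = refl
... | true  | false = refl
... | false | false = refl
... | false | true  = ⊥-elim (subst T i<ᵇj (ℕP.<⇒<ᵇ (crossing⇒< a b cr)))

-- Only the fact that this depends on n alone is used, not its value n(n−1)/2.
pairs : ℕ → ℕ
pairs n = ∑[ i < n ] ∑[ j < n ] ⟦ toℕ i <ᵇ toℕ j ⟧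

twiceHarary : ℕ → ℕ → ℕ → ℕ
twiceHarary a b n = ∑[ i < n ] ∑[ j < n ] twiceInverseDistance a b (toℕ i) (toℕ j)

twiceHarary-+-ab : ∀ n a b → a + b ≤ n → twiceHarary a b n + a * b ≡ 2 * pairs n
twiceHarary-+-ab n a b a+b≤n = begin
  twiceHarary a b n + a * b
    ≡⟨ cong (twiceHarary a b n +_) (sym (count-crossing n a b a+b≤n)) ⟩
  ∑[ i < n ] ∑[ j < n ] d i j + ∑[ i < n ] ∑[ j < n ] χ i j
    ≡⟨ sym (∑-distrib-+ (λ i → ∑[ j < n ] d i j) (λ i → ∑[ j < n ] χ i j)) ⟩
  ∑[ i < n ] (∑[ j < n ] d i j + ∑[ j < n ] χ i j)
    ≡⟨ sum-cong-≗ (λ i → sym (∑-distrib-+ (d i) (χ i))) ⟩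
  ∑[ i < n ] ∑[ j < n ] (d i j + χ i j)
    ≡⟨ ∑∑-cong n n (λ i j → twiceInverseDistance-+-crossing a b (toℕ i) (toℕ j)) ⟩
  ∑[ i < n ] ∑[ j < n ] (2 * ⟦ toℕ i <ᵇ toℕ j ⟧)
    ≡⟨ sum-cong-≗ {n} (λ i → sym (*-distribˡ-sum {n} 2 (λ j → ⟦ toℕ i <ᵇ toℕ j ⟧))) ⟩
  ∑[ i < n ] (2 * ∑[ j < n ] ⟦ toℕ i <ᵇ toℕ j ⟧)
    ≡⟨ sym (*-distribˡ-sum {n} 2 (λ i → ∑[ j < n ] ⟦ toℕ i <ᵇ toℕ j ⟧)) ⟩
  2 * pairs n
    ∎
  where
  open ≡-Reasoning
  d χ : Fin n → Fin n → ℕ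
  d i j = twiceInverseDistance a b (toℕ i) (toℕ j)
  χ i j = ⟦ crossing (part a b (toℕ i)) (part a b (toℕ j)) ⟧

harary-Gabc : ∀ a b c → harary (Gabc a b (suc c)) ≡ halves (twiceHarary a b (a + b + suc c))
harary-Gabc a b c = harary-halves (Gabc a b (suc c)) _ pair-term
  where
  pair-term : ∀ u v → (if toℕ u <ᵇ toℕ v then recip (dist (Gabc a b (suc c)) u v) else 0ℚ)
                      ≡ halves (twiceInverseDistance a b (toℕ u) (toℕ v))
  pair-term u v with toℕ u <ᵇ toℕ v in u<ᵇv
  ... | false = refl
  ... | true  = inverse-distance-Gabc a b c (ℕP.<ᵇ⇒< (toℕ u) (toℕ v) (Equivalence.from T-≡ u<ᵇv))

balanced-< : ∀ {x y a k} → x + a * suc k ≡ y + suc a * k → k ℕ.< a → x ℕ.< y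
balanced-< {x} {y} {a} {k} eq k<a = ℕP.+-cancelʳ-< k x y (begin-strict
  x + k  <⟨ ℕP.+-monoʳ-< x k<a ⟩
  x + a  ≡⟨ ℕP.+-cancelʳ-≡ (a * k) (x + a) (y + k) regrouped ⟩
  y + k  ∎)
  where
  open ℕP.≤-Reasoning
  regrouped : x + a + a * k ≡ y + k + a * k
  regrouped = begin-equality
    x + a + a * k    ≡⟨ ℕP.+-assoc x a (a * k) ⟩
    x + (a + a * k)  ≡⟨ cong (x +_) (sym (ℕP.*-suc a k)) ⟩
    x + a * suc k    ≡⟨ eq ⟩
    y + (k + a * k)  ≡⟨ sym (ℕP.+-assoc y k (a * k)) ⟩
    y + k + a * k    ∎

mainTheorem5 : (n₁ n₂ n₃ : ℕ) → n₂ ≤ n₁ → 2 ≤ n₂ → 1 ≤ n₃ →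
    harary (Gabc n₁ n₂ n₃) < harary (Gabc (suc n₁) (n₂ ∸ 1) n₃)
mainTheorem5 a (suc (suc k)) (suc c) b≤a _ _ =
  subst₂ _<_ (sym (harary-Gabc a (2 + k) c)) (sym (harary-Gabc (suc a) (suc k) c))
    (halves-< (balanced-< same-total b≤a))
  where
  same-total : twiceHarary a (2 + k) (a + (2 + k) + suc c) + a * (2 + k)
             ≡ twiceHarary (suc a) (suc k) (suc a + suc k + suc c) + suc a * suc k
  same-total = begin
    twiceHarary a (2 + k) (a + (2 + k) + suc c) + a * (2 + k)
      ≡⟨ twiceHarary-+-ab _ a (2 + k) (ℕP.m≤m+n _ _) ⟩
    2 * pairs (a + (2 + k) + suc c)
      ≡⟨ cong (λ n → 2 * pairs (n + suc c)) (ℕP.+-suc a (suc k)) ⟩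
    2 * pairs (suc a + suc k + suc c)
      ≡⟨ twiceHarary-+-ab _ (suc a) (suc k) (ℕP.m≤m+n _ _) ⟨
    twiceHarary (suc a) (suc k) (suc a + suc k + suc c) + suc a * suc k
      ∎
    where open ≡-Reasoning
mainTheorem5 _ (suc zero) _ _ (s≤s ()) _
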